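{- For all integers $n \ge 0$, \[ \det \begin{pmatrix} F_{n}-1 & F_{n+1}-1 & F_{n+2}-1 \\ F_{n+1}-1 & F_{n+2}-1 & F_{n+3}-1 \\ F_{n+2}-1 & F_{n+3}-1 & F_{n+4}-1 \end{pmatrix} =(-1)^n . \]
   Context: Here $(F_k)_{k\ge 0}$ denotes the Fibonacci sequence, defined by $F_0=0$, $F_1=1$ and $F_{k+2}=F_{k+1}+F_k$. The classical Cassini identity is $F_{n}F_{n+2}-F_{n+1}^2=(-1)^{n+1}$, equivalently $F_{n-1}F_{n+1}-F_n^2=(-1)^n$. -}

module Defs where

open import Data.Nat using (ℕ; zero; suc)
open import Data.Integer using (ℤ; +_; _+_; _-_; _*_; -_)
open import Data.Fin using (Fin; zero; suc; toℕ)

F : ℕ → ℕ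
F zero = zero
F (suc zero) = suc zero
F (suc (suc k)) = F (suc k) Data.Nat.+ F k

Matrix3 : Set
Matrix3 = Fin 3 → Fin 3 → ℤ

i0 i1 i2 : Fin 3
i0 = zero
i1 = suc zero
i2 = suc (suc zero)

det3 : Matrix3 → ℤ
det3 A =
    A i0 i0 * A i1 i1 * A i2 i2
  + A i0 i1 * A i1 i2 * A i2 i0
  + A i0 i2 * A i1 i0 * A i2 i1
  - A i0 i2 * A i1 i1 * A i2 i0
  - A i0 i0 * A i1 i2 * A i2 i1
  - A i0 i1 * A i1 i0 * A i2 i2

fibMinusOneMatrix : ℕ → Matrix3
fibMinusOneMatrix n i j = + F (n Data.Nat.+ toℕ i Data.Nat.+ toℕ j) - + 1

open import Relation.Binary.PropositionalEquality using (_≡_; refl)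
private
  t0 : det3 (fibMinusOneMatrix 0) ≡ + 1
  t0 = refl
  t1 : det3 (fibMinusOneMatrix 5) ≡ - + 1
  t1 = refl

-- For any sequence u with the Fibonacci recurrence, expanding the determinant of the
-- Hankel matrix (u (i + j) - 1) after writing u 2, u 3, u 4 in terms of u 0, u 1 leaves
-- exactly the Cassini form u 1² - u 1 u 0 - u 0²; the -1's cancel.  Shifting the
-- sequence by one negates the Cassini form, and for (F n, F (n + 1)) it starts at 1.
module Submission where

open import Function using (_∘_)
open import Data.Nat using (ℕ; zero; suc)
import Data.Nat as ℕ
open import Data.Nat.Properties using (+-assoc; +-comm)
open import Data.Integer using (ℤ; -_; +_; _^_; _+_; _-_; _*_)
open import Data.Integer.Properties using (pos-+; -1*i≡-i)
open import Data.Integer.Tactic.RingSolver using (solve-∀)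
open import Data.Fin using (toℕ)
open import Relation.Binary.PropositionalEquality
open ≡-Reasoning

open import Defs

IsFibonacciLike : (ℕ → ℤ) → Set
IsFibonacciLike u = ∀ k → u (suc (suc k)) ≡ u (suc k) + u k

hankelMinusOne : (ℕ → ℤ) → Matrix3
hankelMinusOne u i j = u (toℕ i ℕ.+ toℕ j) - + 1

cassini : (ℕ → ℤ) → ℤ
cassini u = u 1 * u 1 - u 1 * u 0 - u 0 * u 0

det3-cong : ∀ {A B : Matrix3} → (∀ i j → A i j ≡ B i j) → det3 A ≡ det3 B
det3-cong A≗B
  rewrite A≗B i0 i0 | A≗B i0 i1 | A≗B i0 i2
        | A≗B i1 i0 | A≗B i1 i1 | A≗B i1 i2
        | A≗B i2 i0 | A≗B i2 i1 | A≗B i2 i2 = refl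

-- The left side is det3 (hankelMinusOne u) with u 0 = a, u 1 = b and u 2, u 3, u 4
-- unfolded by the recurrence.
hankelDeterminantIdentity : ∀ a b →
    (a - + 1) * (b + a - + 1) * (b + a + b + (b + a) - + 1)
  + (b - + 1) * (b + a + b - + 1) * (b + a - + 1)
  + (b + a - + 1) * (b - + 1) * (b + a + b - + 1)
  - (b + a - + 1) * (b + a - + 1) * (b + a - + 1)
  - (a - + 1) * (b + a + b - + 1) * (b + a + b - + 1)
  - (b - + 1) * (b - + 1) * (b + a + b + (b + a) - + 1)
  ≡ b * b - b * a - a * a
hankelDeterminantIdentity = solve-∀

det3-hankelMinusOne : ∀ u → IsFibonacciLike u → det3 (hankelMinusOne u) ≡ cassini u
det3-hankelMinusOne u rec rewrite rec 2 | rec 1 | rec 0 =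
  hankelDeterminantIdentity (u 0) (u 1)

cassiniShiftIdentity : ∀ a b → (b + a) * (b + a) - (b + a) * b - b * b ≡ - (b * b - b * a - a * a)
cassiniShiftIdentity = solve-∀

cassini-shift : ∀ u → IsFibonacciLike u → cassini (u ∘ suc) ≡ - cassini u
cassini-shift u rec rewrite rec 0 = cassiniShiftIdentity (u 0) (u 1)

fibFrom : ℕ → ℕ → ℤ
fibFrom n k = + F (k ℕ.+ n)

fibFrom-isFibonacciLike : ∀ n → IsFibonacciLike (fibFrom n)
fibFrom-isFibonacciLike n k = pos-+ (F (suc (k ℕ.+ n))) (F (k ℕ.+ n))

-- cassini (fibFrom n) only reads off F n and F (1 + n), so
-- cassini (fibFrom (suc n)) and cassini (fibFrom n ∘ suc) agree definitionally.
cassini-fibFrom : ∀ n → cassini (fibFrom n) ≡ (- + 1) ^ n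
cassini-fibFrom zero    = refl
cassini-fibFrom (suc n) = begin
  cassini (fibFrom n ∘ suc)  ≡⟨ cassini-shift (fibFrom n) (fibFrom-isFibonacciLike n) ⟩
  - cassini (fibFrom n)      ≡⟨ cong -_ (cassini-fibFrom n) ⟩
  - (- + 1) ^ n              ≡⟨ -1*i≡-i ((- + 1) ^ n) ⟨
  (- + 1) ^ suc n            ∎

fibMinusOneMatrix-hankel : ∀ n i j → fibMinusOneMatrix n i j ≡ hankelMinusOne (fibFrom n) i j
fibMinusOneMatrix-hankel n i j = cong (λ m → + F m - + 1)
  (trans (+-assoc n (toℕ i) (toℕ j)) (+-comm n (toℕ i ℕ.+ toℕ j)))

lemma3 : (n : ℕ) → det3 (fibMinusOneMatrix n) ≡ (- + 1) ^ n
lemma3 n = begin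
  det3 (fibMinusOneMatrix n)         ≡⟨ det3-cong (fibMinusOneMatrix-hankel n) ⟩
  det3 (hankelMinusOne (fibFrom n))  ≡⟨ det3-hankelMinusOne (fibFrom n) (fibFrom-isFibonacciLike n) ⟩
  cassini (fibFrom n)                ≡⟨ cassini-fibFrom n ⟩
  (- + 1) ^ n                        ∎
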